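{- For every connected graph $G=(V,E)$, $b_{\mathsf{fa}}(G)\leq 2\,\min_{s\in V} b(G,s)$.
   Context: Broadcasting in a connected graph $G$: initially only a source vertex $s$ holds a message; time proceeds in synchronous rounds, and in each round every informed vertex may transmit the message to at most one of its neighbors. $b(G,s)$ is the minimum number of rounds needed to inform all vertices from source $s$ using an arbitrary (source-dependent) protocol. Fully-adaptive source-oblivious model: each vertex $v$ is assigned a single ordered list $\ell_v$ of distinct neighbors of $v$ (independent of the source). Once $v$ is informed, in each subsequent round it sends the message to the first vertex of $\ell_v$ that is not already informed at the start of that round (informed neighbors are skipped); $v$ stops when all vertices in its list are informed. For lists $L=(\ell_v)_{v\in V}$ and source $s$, $b_{\mathsf{fa}}(G,s,L)$ is the number of rounds until all vertices are informed, and $b_{\mathsf{fa}}(G)=\min_L\max_{s\in V} b_{\mathsf{fa}}(G,s,L)$. -}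

module Defs where

open import Data.Nat using (ℕ; zero; suc)
open import Data.Fin using (Fin; _≟_)
open import Data.Bool using (Bool; true; false; _∧_; _∨_; if_then_else_)
open import Data.Maybe using (Maybe; just; nothing)
open import Data.List using (List; []; _∷_)
open import Data.List.Base using (allFin)
open import Data.Bool.ListAction using (any)
open import Data.List.Relation.Unary.All using (All)
open import Data.List.Relation.Unary.Unique.Propositional using (Unique)
open import Data.Product using (Σ; _×_)
open import Relation.Binary.PropositionalEquality using (_≡_)
open import Relation.Nullary using (¬_)
open import Relation.Nullary.Decidable using (⌊_⌋)

record Graph (n : ℕ) : Set₁ where
  field
    Adj    : Fin n → Fin n → Set
    sym    : ∀ {u v} → Adj u v → Adj v u
    irrefl : ∀ {u} → ¬ Adj u u
open Graph public

data Reachable {n : ℕ} (G : Graph n) : Fin n → Fin n → Set where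
  here : ∀ {u} → Reachable G u u
  step : ∀ {u w v} → Adj G u w → Reachable G w v → Reachable G u v

Connected : ∀ {n} → Graph n → Set
Connected G = ∀ u v → Reachable G u v

InfSet : ℕ → Set
InfSet n = Fin n → Bool

AllInformed : ∀ {n} → InfSet n → Set
AllInformed I = ∀ v → I v ≡ true

hits : ∀ {n} → Maybe (Fin n) → Fin n → Bool
hits nothing  w = false
hits (just v) w = ⌊ v ≟ w ⌋

-- One synchronous round: each vertex u chooses at most one target c u;
-- only calls made by vertices informed at the start of the round count.
round : ∀ {n} → InfSet n → (Fin n → Maybe (Fin n)) → InfSet n
round {n} I c w = I w ∨ any (λ u → I u ∧ hits (c u) w) (allFin n)

initial : ∀ {n} → Fin n → InfSet n
initial s v = ⌊ s ≟ v ⌋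

-- Arbitrary (source-dependent) protocols.
-- A protocol assigns to round t+1 (index t) and each vertex u at most one
-- target vertex, which must be a neighbour of u.

Protocol : ℕ → Set
Protocol n = ℕ → Fin n → Maybe (Fin n)

ValidProtocol : ∀ {n} → Graph n → Protocol n → Set
ValidProtocol G P = ∀ t u v → P t u ≡ just v → Adj G u v

informed : ∀ {n} → Protocol n → Fin n → ℕ → InfSet n
informed P s zero    = initial s
informed P s (suc t) = round (informed P s t) (P t)

-- b(G,s) ≤ t
BroadcastsWithin : ∀ {n} → Graph n → Fin n → ℕ → Set
BroadcastsWithin G s t =
  Σ (Protocol _) λ P → ValidProtocol G P × AllInformed (informed P s t)

Lists : ℕ → Set
Lists n = Fin n → List (Fin n)

ValidLists : ∀ {n} → Graph n → Lists n → Set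
ValidLists G L = ∀ v → All (Adj G v) (L v) × Unique (L v)

-- first vertex of the list not informed (nothing = vertex has stopped)
firstUninformed : ∀ {n} → InfSet n → List (Fin n) → Maybe (Fin n)
firstUninformed I []       = nothing
firstUninformed I (x ∷ xs) = if I x then firstUninformed I xs else just x

faInformed : ∀ {n} → Lists n → Fin n → ℕ → InfSet n
faInformed L s zero    = initial s
faInformed L s (suc t) =
  let I = faInformed L s t in round I (λ u → firstUninformed I (L u))

FABroadcastsWithin : ∀ {n} → Lists n → Fin n → ℕ → Set
FABroadcastsWithin L s t = AllInformed (faInformed L s t)

-- b_fa(G) ≤ t  (there are lists working within t rounds for every source)
FAWithin : ∀ {n} → Graph n → ℕ → Set
FAWithin {n} G t =
  Σ (Lists n) λ L → ValidLists G L × (∀ s → FABroadcastsWithin L s t)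

-- Fix a protocol P informing everything from s₀ within t rounds, let τ v be
-- the round in which v is first informed, and let the informer of v ≠ s₀ be
-- a vertex calling v in round τ v. The list of u is its informer followed by
-- the vertices u newly informs in P, in the order u calls them.
-- From a source s the message climbs the informer tree to s₀ within τ s
-- rounds, because every vertex first calls its informer and τ strictly
-- decreases along the climb. It then descends: by induction on τ w, every w is
-- informed by round τ s + τ w, since its informer u is informed by τ s + τ u,
-- u skips its own (already informed) informer, and the children c of u carry
-- strictly increasing deadlines τ s + τ c > τ s + τ u. Hence 2t rounds suffice.
module Submission where

open import Defs
open import Data.Nat using (ℕ; _*_)
open import Data.Fin using (Fin)

open import Data.Nat using (zero; suc; pred; _+_; _≤_; _<_; z≤n; s≤s; _≤′_; ≤′-refl; ≤′-step; ≢-nonZero)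
open import Data.Nat.Properties
  using (≤-trans; <-trans; <⇒≤; <-irrefl; ≤⇒≤′; n<1+n; m≤m+n; m≤n+m; +-suc; +-identityʳ;
         +-monoʳ-≤; +-monoʳ-<; +-mono-≤; ≤∧≢⇒<; suc-pred; <⇒≱)
  renaming (_≟_ to _≟ℕ_)
open import Data.Nat.Induction using (<-wellFounded)
open import Data.Fin using (_≟_)
open import Data.Bool using (Bool; true; false; T; _∧_; if_then_else_)
open import Data.Bool.Properties using (T-≡; T-∧; ¬-not) renaming (_≟_ to _≟ᵇ_)
open import Data.Maybe using (Maybe; just; nothing)
open import Data.List using (List; []; _∷_; _++_; filter; fromMaybe; allFin)
open import Data.List.Properties using (++-assoc)
open import Data.List.Relation.Unary.All as All using (All; []; _∷_)
open import Data.List.Relation.Unary.All.Properties using (++⁺; all-filter)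
import Data.List.Relation.Unary.All.Properties as All
open import Data.List.Relation.Unary.AllPairs as AllPairs using (AllPairs; []; _∷_)
import Data.List.Relation.Unary.AllPairs.Properties as AllPairs
open import Data.List.Relation.Unary.Any as Any using (Any; any?; satisfied)
open import Data.List.Relation.Unary.Any.Properties using (any⁺; any⁻)
open import Data.List.Membership.Propositional using (_∈_)
open import Data.List.Membership.Propositional.Properties using (∈-filter⁺; ∈-++⁺ˡ; ∈-++⁺ʳ; ∈-allFin)
open import Data.Product using (_,_; proj₁; proj₂)
open import Data.Empty using (⊥-elim)
open import Function using (_on_; _∘_)
open import Function.Bundles using (Equivalence)
import Induction.WellFounded as WF
open import Relation.Binary.Construct.On using (wellFounded)
open import Relation.Binary.PropositionalEquality as ≡ using (_≡_; _≢_; refl; cong; subst; trans)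
open import Relation.Nullary using (Dec; yes; no)
open import Relation.Nullary.Decidable using (toWitness; fromWitness; T?)

open Equivalence using (to; from)

least : (ℕ → Bool) → ℕ → ℕ
least f zero    = zero
least f (suc k) = if f zero then zero else suc (least (f ∘ suc) k)

least-≤ : ∀ (f : ℕ → Bool) k → least f k ≤ k
least-≤ f zero    = z≤n
least-≤ f (suc k) with f zero
... | true  = z≤n
... | false = s≤s (least-≤ (f ∘ suc) k)

least-holds : ∀ (f : ℕ → Bool) k → f k ≡ true → f (least f k) ≡ true
least-holds f zero    fk = fk
least-holds f (suc k) fk with f zero in f0
... | true  = f0
... | false = least-holds (f ∘ suc) k fk

least-minimal : ∀ (f : ℕ → Bool) k r → f r ≡ true → least f k ≤ r
least-minimal f zero    r       fr = z≤n
least-minimal f (suc k) zero    fr rewrite fr = z≤n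
least-minimal f (suc k) (suc r) fr with f zero
... | true  = z≤n
... | false = s≤s (least-minimal (f ∘ suc) k r fr)

stays-true : ∀ {n} (J : ℕ → InfSet n) → (∀ {r} v → J r v ≡ true → J (suc r) v ≡ true) →
             ∀ {r r′} v → r ≤ r′ → J r v ≡ true → J r′ v ≡ true
stays-true J persists {r} v r≤r′ Jv = go (≤⇒≤′ r≤r′)
  where
  go : ∀ {r′} → r ≤′ r′ → J r′ v ≡ true
  go ≤′-refl          = Jv
  go (≤′-step r≤′r′) = persists v (go r≤′r′)

hits-≡ : ∀ {n} (m : Maybe (Fin n)) {v} → T (hits m v) → m ≡ just v
hits-≡ (just w) h = cong just (toWitness h)

initial-≡ : ∀ {n} (s : Fin n) {v} → initial s v ≡ true → s ≡ v
initial-≡ s h = toWitness (from T-≡ h)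

initial-source : ∀ {n} (s : Fin n) → initial s s ≡ true
initial-source s = to T-≡ (fromWitness refl)

round-extensive : ∀ {n} (I : InfSet n) c w → I w ≡ true → round I c w ≡ true
round-extensive I c w Iw rewrite Iw = refl

round-call : ∀ {n} (I : InfSet n) c {u w} → I u ≡ true → c u ≡ just w → round I c w ≡ true
round-call I c {u} {w} Iu cu with I w
... | true  = refl
... | false = to T-≡ (any⁺ _ (Any.map called (∈-allFin u)))
  where
  called : ∀ {x} → u ≡ x → T (I x ∧ hits (c x) w)
  called refl rewrite Iu | cu = fromWitness refl

round-newcomer : ∀ {n} (I : InfSet n) c w → I w ≡ false → round I c w ≡ true →
                 Any (λ u → T (I u ∧ hits (c u) w)) (allFin n)
round-newcomer I c w Iw h rewrite Iw = any⁻ _ _ (from T-≡ h)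

firstUninformed-after : ∀ {n} (I : InfSet n) pre {y} ys → All (λ x → I x ≡ true) pre →
                        I y ≡ false → firstUninformed I (pre ++ y ∷ ys) ≡ just y
firstUninformed-after I []        ys []         Iy rewrite Iy = refl
firstUninformed-after I (x ∷ pre) ys (Ix ∷ Ipre) Iy rewrite Ix =
  firstUninformed-after I pre ys Ipre Iy

module FullyAdaptive {n} (L : Lists n) (s : Fin n) where

  F : ℕ → InfSet n
  F = faInformed L s

  calls : ℕ → Fin n → Maybe (Fin n)
  calls r u = firstUninformed (F r) (L u)

  F-mono : ∀ {r r′} v → r ≤ r′ → F r v ≡ true → F r′ v ≡ true
  F-mono = stays-true F (λ {r} v → round-extensive (F r) (calls r) v)

  F-next : ∀ {a u} pre {y} ys → L u ≡ pre ++ y ∷ ys → F a u ≡ true →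
           All (λ x → F a x ≡ true) pre → F (suc a) y ≡ true
  F-next {a} {u} pre {y} ys Lu Fu Fpre with F a y ≟ᵇ true
  ... | yes Fy = round-extensive (F a) (calls a) y Fy
  ... | no ¬Fy = round-call (F a) (calls a) Fu (trans (cong (firstUninformed (F a)) Lu)
                                              (firstUninformed-after (F a) pre ys Fpre (¬-not ¬Fy)))

  F-deadlines : ∀ {a u} pre ys (d : Fin n → ℕ) → L u ≡ pre ++ ys → F a u ≡ true →
                All (λ x → F a x ≡ true) pre → All (λ y → a < d y) ys →
                AllPairs (λ x y → d x < d y) ys → All (λ y → F (d y) y ≡ true) ys
  F-deadlines pre []       d Lu Fu Fpre []           []             = []
  F-deadlines {a} {u} pre (y ∷ ys) d Lu Fu Fpre (a<dy ∷ a<dys) (dy<dys ∷ dys↑) =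
    Fy ∷ F-deadlines (pre ++ y ∷ []) ys d Lu′ (F-mono u (<⇒≤ a<dy) Fu)
                     (++⁺ (All.map (λ {x} → F-mono x (<⇒≤ a<dy)) Fpre) (Fy ∷ [])) dy<dys dys↑
    where
    Fy : F (d y) y ≡ true
    Fy = F-mono y a<dy (F-next {a} pre ys Lu Fu Fpre)
    Lu′ : L u ≡ (pre ++ y ∷ []) ++ ys
    Lu′ = trans Lu (≡.sym (++-assoc pre (y ∷ []) ys))

module FromProtocol {n} (G : Graph n) (s₀ : Fin n) (t : ℕ) (P : Protocol n)
                    (P-valid : ValidProtocol G P) (P-complete : AllInformed (informed P s₀ t)) where

  I : ℕ → InfSet n
  I = informed P s₀

  τ : Fin n → ℕ
  τ v = least (λ r → I r v) t

  τ-informed : ∀ v → I (τ v) v ≡ true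
  τ-informed v = least-holds (λ r → I r v) t (P-complete v)

  τ-≤ : ∀ v → τ v ≤ t
  τ-≤ v = least-≤ (λ r → I r v) t

  τ-minimal : ∀ v {r} → I r v ≡ true → τ v ≤ r
  τ-minimal v {r} = least-minimal (λ r → I r v) t r

  uninformed-before-τ : ∀ v {r} → r < τ v → I r v ≡ false
  uninformed-before-τ v r<τ = ¬-not (λ Iv → <⇒≱ r<τ (τ-minimal v Iv))

  τ-suc-pred : ∀ v → v ≢ s₀ → τ v ≡ suc (pred (τ v))
  τ-suc-pred v v≢s₀ = ≡.sym (suc-pred (τ v) {{≢-nonZero τ≢0}})
    where
    τ≢0 : τ v ≢ 0
    τ≢0 τ≡0 = v≢s₀ (≡.sym (initial-≡ s₀ (subst (λ r → I r v ≡ true) τ≡0 (τ-informed v))))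

  Calls : ℕ → Fin n → Fin n → Set
  Calls r v u = T (I r u ∧ hits (P r u) v)

  informerSearch : ∀ v → Dec (Any (Calls (pred (τ v)) v) (allFin n))
  informerSearch v = any? (λ u → T? (I (pred (τ v)) u ∧ hits (P (pred (τ v)) u) v)) (allFin n)

  -- junk value v when nobody calls v in round τ v, which happens only for v = s₀
  informer : Fin n → Fin n
  informer v with informerSearch v
  ... | yes calls = proj₁ (satisfied calls)
  ... | no  _     = v

  informer-calls : ∀ v → v ≢ s₀ → Calls (pred (τ v)) v (informer v)
  informer-calls v v≢s₀ with informerSearch v
  ... | yes calls = proj₂ (satisfied calls)
  ... | no ¬calls = ⊥-elim (¬calls (round-newcomer (I r) (P r) v
                                      (uninformed-before-τ v (subst (r <_) (≡.sym τ≡) (n<1+n r)))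
                                      (subst (λ k → I k v ≡ true) τ≡ (τ-informed v))))
    where
    r = pred (τ v)
    τ≡ = τ-suc-pred v v≢s₀

  informer-informed : ∀ v → v ≢ s₀ → I (pred (τ v)) (informer v) ≡ true
  informer-informed v v≢s₀ = to T-≡ (proj₁ (to T-∧ (informer-calls v v≢s₀)))

  P-informer : ∀ v → v ≢ s₀ → P (pred (τ v)) (informer v) ≡ just v
  P-informer v v≢s₀ = hits-≡ (P _ (informer v)) (proj₂ (to T-∧ (informer-calls v v≢s₀)))

  τ-informer : ∀ v → v ≢ s₀ → τ (informer v) < τ v
  τ-informer v v≢s₀ = subst (τ (informer v) <_) (≡.sym (τ-suc-pred v v≢s₀))
                        (s≤s (τ-minimal (informer v) (informer-informed v v≢s₀)))

  newlyCalled : ℕ → Fin n → List (Fin n)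
  newlyCalled r u = filter (λ v → τ v ≟ℕ suc r) (fromMaybe (P r u))

  childrenFrom : Fin n → ℕ → ℕ → List (Fin n)
  childrenFrom u r zero    = []
  childrenFrom u r (suc m) = newlyCalled r u ++ childrenFrom u (suc r) m

  children : Fin n → List (Fin n)
  children u = childrenFrom u (τ u) t

  newlyCalled-adjacent : ∀ r u → All (Adj G u) (newlyCalled r u)
  newlyCalled-adjacent r u with P r u in Pru
  ... | nothing = []
  ... | just v  = All.filter⁺ (λ v → τ v ≟ℕ suc r) (P-valid r u v Pru ∷ [])

  newlyCalled-τ : ∀ r u → All (λ v → τ v ≡ suc r) (newlyCalled r u)
  newlyCalled-τ r u = all-filter (λ v → τ v ≟ℕ suc r) (fromMaybe (P r u))

  newlyCalled-ascending : ∀ r u → AllPairs (_<_ on τ) (newlyCalled r u)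
  newlyCalled-ascending r u with P r u
  ... | nothing = []
  ... | just v  = AllPairs.filter⁺ (λ v → τ v ≟ℕ suc r) ([] ∷ [])

  childrenFrom-adjacent : ∀ u r m → All (Adj G u) (childrenFrom u r m)
  childrenFrom-adjacent u r zero    = []
  childrenFrom-adjacent u r (suc m) =
    ++⁺ (newlyCalled-adjacent r u) (childrenFrom-adjacent u (suc r) m)

  childrenFrom-later : ∀ u r m → All (λ v → r < τ v) (childrenFrom u r m)
  childrenFrom-later u r zero    = []
  childrenFrom-later u r (suc m) =
    ++⁺ (All.map (λ τ≡ → subst (r <_) (≡.sym τ≡) (n<1+n r)) (newlyCalled-τ r u))
        (All.map (<-trans (n<1+n r)) (childrenFrom-later u (suc r) m))

  childrenFrom-ascending : ∀ u r m → AllPairs (_<_ on τ) (childrenFrom u r m)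
  childrenFrom-ascending u r zero    = []
  childrenFrom-ascending u r (suc m) =
    AllPairs.++⁺ (newlyCalled-ascending r u) (childrenFrom-ascending u (suc r) m)
      (All.map (λ τ≡ → All.map (λ {y} → subst (_< τ y) (≡.sym τ≡)) (childrenFrom-later u (suc r) m))
               (newlyCalled-τ r u))

  ∈-childrenFrom : ∀ u v r r′ m → P r u ≡ just v → τ v ≡ suc r → r′ ≤ r → r < r′ + m →
                   v ∈ childrenFrom u r′ m
  ∈-childrenFrom u v r r′ zero    Pru τv r′≤r r<r′ =
    ⊥-elim (<⇒≱ r<r′ (subst (_≤ r) (≡.sym (+-identityʳ r′)) r′≤r))
  ∈-childrenFrom u v r r′ (suc m) Pru τv r′≤r r<r′+m with r′ ≟ℕ r
  ... | yes refl rewrite Pru = ∈-++⁺ˡ (∈-filter⁺ (λ v → τ v ≟ℕ suc r) (Any.here refl) τv)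
  ... | no r′≢r  = ∈-++⁺ʳ (newlyCalled r′ u)
                     (∈-childrenFrom u v r (suc r′) m Pru τv (≤∧≢⇒< r′≤r r′≢r)
                                     (subst (r <_) (+-suc r′ m) r<r′+m))

  ∈-children-informer : ∀ v → v ≢ s₀ → v ∈ children (informer v)
  ∈-children-informer v v≢s₀ =
    ∈-childrenFrom (informer v) v (pred (τ v)) (τ (informer v)) t
      (P-informer v v≢s₀) (τ-suc-pred v v≢s₀) (τ-minimal (informer v) (informer-informed v v≢s₀))
      (≤-trans (subst (_≤ t) (τ-suc-pred v v≢s₀) (τ-≤ v)) (m≤n+m t (τ (informer v))))

  informerList : Fin n → List (Fin n)
  informerList u with u ≟ s₀
  ... | yes _ = []
  ... | no  _ = informer u ∷ []

  lists : Lists n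
  lists u = informerList u ++ children u

  lists-nonSource : ∀ v → v ≢ s₀ → lists v ≡ informer v ∷ children v
  lists-nonSource v v≢s₀ with v ≟ s₀
  ... | yes v≡s₀ = ⊥-elim (v≢s₀ v≡s₀)
  ... | no  _    = refl

  lists-ascending : ∀ u → AllPairs (_<_ on τ) (lists u)
  lists-ascending u with u ≟ s₀
  ... | yes _    = childrenFrom-ascending u (τ u) t
  ... | no u≢s₀ = All.map (<-trans (τ-informer u u≢s₀)) (childrenFrom-later u (τ u) t)
                 ∷ childrenFrom-ascending u (τ u) t

  informerList-adjacent : ∀ u → All (Adj G u) (informerList u)
  informerList-adjacent u with u ≟ s₀
  ... | yes _    = []
  ... | no u≢s₀ = sym G (P-valid _ _ _ (P-informer u u≢s₀)) ∷ []

  lists-valid : ValidLists G lists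
  lists-valid u = ++⁺ (informerList-adjacent u) (childrenFrom-adjacent u (τ u) t)
                , AllPairs.map (λ τx<τy x≡y → <-irrefl (cong τ x≡y) τx<τy) (lists-ascending u)

  τ-induction : (Q : Fin n → Set) → (∀ v → (∀ {u} → τ u < τ v → Q u) → Q v) → ∀ v → Q v
  τ-induction = WF.All.wfRec (wellFounded τ <-wellFounded) _

  module FromSource (s : Fin n) where
    open FullyAdaptive lists s

    reaches-source : ∀ v {a} → F a v ≡ true → F (a + τ v) s₀ ≡ true
    reaches-source = τ-induction (λ v → ∀ {a} → F a v ≡ true → F (a + τ v) s₀ ≡ true) climb
      where
      climb : ∀ v → (∀ {u} → τ u < τ v → ∀ {a} → F a u ≡ true → F (a + τ u) s₀ ≡ true) →
              ∀ {a} → F a v ≡ true → F (a + τ v) s₀ ≡ true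
      climb v IH {a} Fv with v ≟ s₀
      ... | yes refl = F-mono s₀ (m≤m+n a (τ s₀)) Fv
      ... | no v≢s₀  =
        F-mono s₀ (subst (_≤ a + τ v) (+-suc a _) (+-monoʳ-≤ a (τ-informer v v≢s₀)))
          (IH (τ-informer v v≢s₀) {suc a} (F-next {a} [] (children v) (lists-nonSource v v≢s₀) Fv []))

    source-informed : F (τ s) s₀ ≡ true
    source-informed = reaches-source s {0} (initial-source s)

    informed-by : ∀ w → F (τ s + τ w) w ≡ true
    informed-by = τ-induction (λ w → F (τ s + τ w) w ≡ true) descend
      where
      descend : ∀ w → (∀ {u} → τ u < τ w → F (τ s + τ u) u ≡ true) → F (τ s + τ w) w ≡ true
      descend w IH with w ≟ s₀
      ... | yes refl = F-mono s₀ (m≤m+n (τ s) (τ s₀)) source-informed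
      ... | no w≢s₀  =
        All.lookup (F-deadlines (informerList u) (children u) (λ c → τ s + τ c) refl
                      (IH (τ-informer w w≢s₀)) informerList-informed
                      (All.map (+-monoʳ-< (τ s)) (childrenFrom-later u (τ u) t))
                      (AllPairs.map (+-monoʳ-< (τ s)) (childrenFrom-ascending u (τ u) t)))
                   (∈-children-informer w w≢s₀)
        where
        u = informer w
        informerList-informed : All (λ x → F (τ s + τ u) x ≡ true) (informerList u)
        informerList-informed with u ≟ s₀
        ... | yes _    = []
        ... | no u≢s₀ = F-mono (informer u) (+-monoʳ-≤ (τ s) (<⇒≤ (τ-informer u u≢s₀)))
                          (IH (<-trans (τ-informer u u≢s₀) (τ-informer w w≢s₀))) ∷ []

    broadcasts : FABroadcastsWithin lists s (2 * t)
    broadcasts w = F-mono w (+-mono-≤ (τ-≤ s) (≤-trans (τ-≤ w) (m≤m+n t 0))) (informed-by w)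

proposition1 : ∀ {n} (G : Graph n) → Connected G →
    (s₀ : Fin n) (t : ℕ) → BroadcastsWithin G s₀ t → FAWithin G (2 * t)
proposition1 G _ s₀ t (P , P-valid , P-complete) = lists , lists-valid , broadcasts
  where
  open FromProtocol G s₀ t P P-valid P-complete
  open FromSource
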